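{- Let $d\ge2$ and $\mathbf{r}\in\mathcal{R}$. Then $\mathbf{r}+\mathbf{r}'\neq \mathbf{s}-\mathbf{s}'$ for all $\mathbf{r}',\mathbf{s},\mathbf{s}'\in\mathcal{R}\setminus\{\mathbf{0}\}$.
   Context: $\mathbb{N}=\{1,2,\ldots\}$. Fix $d\ge2$. For $n\in\mathbb{N}$ and $i\in\{1,\ldots,d\}$ let $r_i(n)=\left\lfloor \frac{(2^d-1)n}{2^{d-i}}\right\rfloor-2^{i-1}+1$ and $\mathbf{r}(n)=(r_1(n),\ldots,r_d(n))$. Let $\mathcal{R}=\{\mathbf{r}(n):n\in\mathbb{N}\}\cup\{\mathbf{0}\}\subset\mathbb{Z}^d$. -}

module Defs where

open import Data.Nat using (ℕ; zero; suc; _^_; _∸_; _≥_)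
import Data.Nat as ℕ
open import Data.Nat.DivMod using (_/_)
open import Data.Nat.Properties using (m^n≢0)
open import Data.Integer using (ℤ; +_; _-_; _+_)
open import Data.Fin using (Fin; toℕ)
open import Data.Product using (∃; _×_)
open import Data.Sum using (_⊎_)
open import Relation.Binary.PropositionalEquality using (_≡_)
open import Relation.Nullary using (¬_)

-- Vectors in ℤ^d are functions Fin d → ℤ; coordinate k : Fin d corresponds to i = toℕ k + 1.
Vecℤ : ℕ → Set
Vecℤ d = Fin d → ℤ

0v : ∀ {d} → Vecℤ d
0v _ = + 0

_+v_ : ∀ {d} → Vecℤ d → Vecℤ d → Vecℤ d
(u +v v) k = u k + v k

_-v_ : ∀ {d} → Vecℤ d → Vecℤ d → Vecℤ d
(u -v v) k = u k - v k

_≈v_ : ∀ {d} → Vecℤ d → Vecℤ d → Set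
u ≈v v = ∀ k → u k ≡ v k

-- r_i(n) = ⌊(2^d - 1) n / 2^(d-i)⌋ - 2^(i-1) + 1, with i = toℕ k + 1
-- (the floor of a quotient of naturals is ℕ division)
rcoord : (d n : ℕ) → Fin d → ℤ
rcoord d n k =
  (+ (_/_ (((2 ^ d) ∸ 1) ℕ.* n) (2 ^ (d ∸ suc (toℕ k))) {{m^n≢0 2 (d ∸ suc (toℕ k))}}))
    - (+ (2 ^ toℕ k)) + (+ 1)

rvec : (d n : ℕ) → Vecℤ d
rvec d n = rcoord d n

InR : (d : ℕ) → Vecℤ d → Set
InR d v = (v ≈v 0v) ⊎ ∃ λ n → (n ≥ 1) × (v ≈v rvec d n)

InR* : (d : ℕ) → Vecℤ d → Set
InR* d v = InR d v × ¬ (v ≈v 0v)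

-- Only the last coordinate matters. With m = 2^d − 1 and p = 2^(d−1) we have m + 1 = 2p,
-- so r_d(n) = mn − p + 1 = p + m(n − 1) ≡ p (mod m) for every nonzero element of 𝓡.
-- Hence s_d − s′_d ≡ 0, whereas r_d + r′_d ≡ p or 2p ≡ 1 according as r = 0 or not;
-- for d ≥ 2 both 1 and p lie strictly between 0 and m, so neither is divisible by m.
module Submission where

open import Defs
open import Data.Nat using (ℕ; _≥_)
open import Relation.Nullary using (¬_)

open import Data.Nat as ℕ using (suc; _^_; _∸_; _<_; s≤s; z≤n; z<s)
import Data.Nat.Properties as ℕ
open import Data.Nat.Divisibility as ℕ using (>⇒∤; ∣m+n∣m⇒∣n; ∣-refl)
open import Data.Nat.DivMod using (n/1≡n)
open import Data.Integer using (0ℤ; 1ℤ; +_; _-_; _+_; _*_)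
import Data.Integer.Properties as ℤ
open import Data.Integer.Divisibility.Signed using (_∣_; divides; ∣⇒∣ᵤ)
open import Data.Integer.Solver using (module +-*-Solver)
open import Data.Fin using (Fin; fromℕ)
open import Data.Fin.Properties using (toℕ-fromℕ)
open import Data.Product using (∃; _,_)
open import Data.Sum using (inj₁; inj₂)
open import Data.Empty using (⊥-elim)
open import Relation.Binary.PropositionalEquality

open +-*-Solver

2*m∸1+1≡m+m : ∀ m → 0 < m → 2 ℕ.* m ∸ 1 ℕ.+ 1 ≡ m ℕ.+ m
2*m∸1+1≡m+m m 0<m =
  trans (ℕ.m∸n+n≡m {2 ℕ.* m} {1} (ℕ.≤-trans 0<m (ℕ.m≤m+n m _))) (cong (m ℕ.+_) (ℕ.+-identityʳ m))

m<2*m∸1 : ∀ m → 1 < m → m < 2 ℕ.* m ∸ 1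
m<2*m∸1 m 1<m = ℕ.+-cancelʳ-< 1 m (2 ℕ.* m ∸ 1)
  (subst (m ℕ.+ 1 <_) (sym (2*m∸1+1≡m+m m (ℕ.<-trans z<s 1<m))) (ℕ.+-monoʳ-< m 1<m))

1<2^suc : ∀ n → 1 < 2 ^ suc n
1<2^suc n = ℕ.^-monoʳ-< 2 (s≤s (s≤s z≤n)) {0} {suc n} z<s

rcoord-last : ∀ e n →
  rcoord (suc e) n (fromℕ e) ≡ + 2 ^ e + + (2 ^ suc e ∸ 1) * (+ n - 1ℤ)
rcoord-last e n rewrite toℕ-fromℕ e | ℕ.n∸n≡0 e | n/1≡n ((2 ^ suc e ∸ 1) ℕ.* n) = begin
  + (m ℕ.* n) - + p + 1ℤ                               ≡⟨ cong (λ x → x - + p + 1ℤ) (ℤ.pos-* m n) ⟩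
  + m * + n - + p + 1ℤ                                 ≡⟨ rearrange (+ m) (+ n) (+ p) ⟩
  + p + + m * (+ n - 1ℤ) + ((+ m + 1ℤ) - (+ p + + p)) ≡⟨ cong (_+_ (+ p + + m * (+ n - 1ℤ))) m+1-2p≡0 ⟩
  + p + + m * (+ n - 1ℤ) + 0ℤ                          ≡⟨ ℤ.+-identityʳ _ ⟩
  + p + + m * (+ n - 1ℤ)                               ∎
  where
  open ≡-Reasoning
  p m : ℕ
  p = 2 ^ e
  m = 2 ^ suc e ∸ 1
  m+1-2p≡0 : (+ m + 1ℤ) - (+ p + + p) ≡ 0ℤ
  m+1-2p≡0 = ℤ.i≡j⇒i-j≡0 (cong +_ (2*m∸1+1≡m+m p (ℕ.m^n>0 2 e)))
  rearrange : ∀ m n p → m * n - p + 1ℤ ≡ p + m * (n - 1ℤ) + ((m + 1ℤ) - (p + p))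
  rearrange = solve 3 (λ m n p → m :* n :- p :+ con 1ℤ
                         := p :+ m :* (n :- con 1ℤ) :+ ((m :+ con 1ℤ) :- (p :+ p))) refl

last-coordinate-of-InR* : ∀ e (v : Vecℤ (suc e)) → InR* (suc e) v →
  ∃ λ u → v (fromℕ e) ≡ + 2 ^ e + + (2 ^ suc e ∸ 1) * u
last-coordinate-of-InR* e v (inj₁ v≈0 , v≉0)           = ⊥-elim (v≉0 v≈0)
last-coordinate-of-InR* e v (inj₂ (n , _ , v≈r) , _) = + n - 1ℤ , trans (v≈r (fromℕ e)) (rcoord-last e n)

residue-of-sum : ∀ q a p m b c e →
  (q + m * a) + (p + m * b) ≡ (p + m * c) - (p + m * e) → m ∣ q + p
residue-of-sum q a p m b c e eq = divides (c - e - a - b) (ℤ.i-j≡0⇒i≡j _ _ (begin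
  q + p - (c - e - a - b) * m                           ≡⟨ rearrange q a p m b c e ⟩
  (q + m * a) + (p + m * b) - ((p + m * c) - (p + m * e)) ≡⟨ ℤ.i≡j⇒i-j≡0 eq ⟩
  0ℤ                                                     ∎))
  where
  open ≡-Reasoning
  rearrange : ∀ q a p m b c e → q + p - (c - e - a - b) * m
            ≡ (q + m * a) + (p + m * b) - ((p + m * c) - (p + m * e))
  rearrange = solve 7 (λ q a p m b c e → q :+ p :- (c :- e :- a :- b) :* m
                := (q :+ m :* a) :+ (p :+ m :* b) :- ((p :+ m :* c) :- (p :+ m :* e))) refl

lemma2 : (d : ℕ) → d ≥ 2 → (r : Vecℤ d) → InR d r →
    (r′ s s′ : Vecℤ d) → InR* d r′ → InR* d s → InR* d s′ →
    ¬ ((r +v r′) ≈v (s -v s′))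
lemma2 (suc (suc e)) (s≤s (s≤s z≤n)) r r∈R r′ s s′ r′∈R* s∈R* s′∈R* r+r′≈s-s′
  with last-coordinate-of-InR* _ r′ r′∈R*
     | last-coordinate-of-InR* _ s s∈R*
     | last-coordinate-of-InR* _ s′ s′∈R*
... | b , r′≡ | c , s≡ | e′ , s′≡ = excluded r∈R
  where
  k : Fin (suc (suc e))
  k = fromℕ (suc e)
  p m : ℕ
  p = 2 ^ suc e
  m = 2 ^ suc (suc e) ∸ 1
  p<m : p < m
  p<m = m<2*m∸1 p (1<2^suc e)
  1<m : 1 < m
  1<m = ℕ.<-trans (1<2^suc e) p<m
  m+1≡2p : m ℕ.+ 1 ≡ p ℕ.+ p
  m+1≡2p = 2*m∸1+1≡m+m p (ℕ.m^n>0 2 (suc e))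
  last-equation : ∀ {x} → r k ≡ x → x + (+ p + + m * b) ≡ (+ p + + m * c) - (+ p + + m * e′)
  last-equation r≡ = trans (sym (cong₂ _+_ r≡ r′≡)) (trans (r+r′≈s-s′ k) (cong₂ _-_ s≡ s′≡))
  excluded : ¬ InR _ r
  excluded (inj₁ r≈0) = >⇒∤ {{ℕ.m^n≢0 2 (suc e)}} p<m (∣⇒∣ᵤ m∣p)
    where
    r≡0+m*0 : r k ≡ 0ℤ + + m * 0ℤ
    r≡0+m*0 = trans (r≈0 k) (sym (trans (ℤ.+-identityˡ _) (ℤ.*-zeroʳ (+ m))))
    m∣p : + m ∣ + p
    m∣p = residue-of-sum 0ℤ 0ℤ (+ p) (+ m) b c e′ (last-equation r≡0+m*0)
  excluded (inj₂ (a , _ , r≈r)) = >⇒∤ 1<m (∣m+n∣m⇒∣n (subst (m ℕ.∣_) (sym m+1≡2p) (∣⇒∣ᵤ m∣2p)) ∣-refl)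
    where
    m∣2p : + m ∣ + p + + p
    m∣2p = residue-of-sum (+ p) (+ a - 1ℤ) (+ p) (+ m) b c e′
             (last-equation (trans (r≈r k) (rcoord-last (suc e) a)))
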